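{- Let $\mathcal{L}$ be a first-order language and $\mathcal{C}$ a set of parameters. For every formula $A \in \mathcal{F}(\mathcal{L},\mathcal{C})$, every index $i \ge 1$ and every variable $x$: 1. If $A$ is independent of $x_{i+1}$, then $\forall A = (\forall x_i)(A[x_i, x_1, x_2, \ldots])$. 2. If $A$ is independent of $x$, then $(\forall x)A = \forall(A^+)$. 3. $(\forall x_1)A = (\forall A)^+$ and $\forall A = ((\forall x_1)A)^-$. 4. $(\forall x_i)A = ((\forall x_1)(A[x_2, x_3, \ldots, x_i, x_1, x_{i+2}, \ldots]))^-$.
   Context: A (first-order) language $\mathcal{L}$ is a nonempty set of $n$-ary function symbols and $n$-ary predicate symbols ($n \ge 0$), containing a $0$-ary predicate symbol $\mathbb{F}$. Fix a set of variables $X = \{x_1, x_2, \ldots\}$ and a (possibly empty) set $\mathcal{C}$ of parameters. The terms $\mathcal{T}(\mathcal{L},\mathcal{C})$ form the smallest set of expressions containing the $0$-ary function symbols, the variables and the parameters, and closed under: if $t_1,\ldots,t_n$ are terms and $f$ is an $n$-ary function symbol then $f(t_1,\ldots,t_n)$ is a term. Atomic formulas are the $0$-ary predicate symbols and the expressions $P(t_1,\ldots,t_n)$ with $P$ an $n$-ary predicate symbol and $t_i$ terms. The formulas $\mathcal{F}(\mathcal{L},\mathcal{C})$ form the smallest set containing the atomic formulas and closed under: if $A,B$ are formulas then so are $(A \Rightarrow B)$ and $(\forall A)$; here $\forall$ is a unary formula constructor not attached to any variable. Simultaneous substitution: for a term or formula $D$ and a sequence of terms $t_1,t_2,\ldots$,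 define $D[t_1,t_2,\ldots]$ inductively by: $x_i[t_1,t_2,\ldots] = t_i$; $c[t_1,t_2,\ldots] = c$ for parameters $c$; $f(s_1,\ldots,s_n)[t_1,t_2,\ldots] = f(s_1[t_1,t_2,\ldots],\ldots,s_n[t_1,t_2,\ldots])$ (so $0$-ary symbols are unchanged); $P(s_1,\ldots,s_n)[t_1,t_2,\ldots] = P(s_1[t_1,t_2,\ldots],\ldots,s_n[t_1,t_2,\ldots])$; $(A\Rightarrow B)[t_1,t_2,\ldots] = (A[t_1,t_2,\ldots] \Rightarrow B[t_1,t_2,\ldots])$; $(\forall A)[t_1,t_2,\ldots] = \forall(A[x_1, t_1^+, t_2^+, \ldots])$ where $t^+ := t[x_2,x_3,\ldots]$. (Thus $\forall$ binds the variable $x_1$ of its argument.) Notation: $D[t/x_i] := D[x_1,\ldots,x_{i-1},t,x_{i+1},\ldots]$; $D^+ := D[x_2,x_3,\ldots]$; $D^- := D[x_1,x_1,x_2,x_3,\ldots]$. In item 1, $A[x_i,x_1,x_2,\ldots]$ is the substitution placing $x_i$ in position 1 and $x_{k-1}$ in position $k$ for $k \ge 2$. $D$ is independent of the variable $x_i$ if $D = D[x_{i+1}/x_i]$; otherwise $x_i$ is free in $D$. For a variable $x_i$, $(\forall x_i)A := \forall(A[x_2,x_3,\ldots,x_i,x_1,x_{i+2},\ldots])$, i.e. the substituted sequence has $x_{j+1}$ in position $j$ for each $j \ne i$ and $x_1$ in position $i$. -}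

module Defs where

open import Data.Nat using (ℕ; zero; suc; _≡ᵇ_)
open import Data.Vec using (Vec; []; _∷_)
open import Data.Bool using (if_then_else_)
open import Relation.Binary.PropositionalEquality using (_≡_)

record Language : Set₁ where
  field
    FunSym    : Set
    funArity  : FunSym → ℕ
    PredSym   : Set
    predArity : PredSym → ℕ
    𝔽         : PredSym
    𝔽-arity   : predArity 𝔽 ≡ 0

open Language public

-- Variables: `var n` is the variable x_{n+1} (so `var 0` = x₁).
-- 0-ary function symbols are `app f []`.
data Term (L : Language) (C : Set) : Set where
  var : ℕ → Term L C
  par : C → Term L C
  app : (f : FunSym L) → Vec (Term L C) (funArity L f) → Term L C

-- 0-ary predicate symbols are `atom P []`; `all A` is the binder-free ∀A.
data Formula (L : Language) (C : Set) : Set where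
  atom : (P : PredSym L) → Vec (Term L C) (predArity L P) → Formula L C
  _⇒_  : Formula L C → Formula L C → Formula L C
  all  : Formula L C → Formula L C

-- A sequence of terms t₁, t₂, …  (position k+1 is `σ k`).
Seq : Language → Set → Set
Seq L C = ℕ → Term L C

module _ {L : Language} {C : Set} where

  substT  : Seq L C → Term L C → Term L C
  substTs : ∀ {n} → Seq L C → Vec (Term L C) n → Vec (Term L C) n
  substT σ (var i)    = σ i
  substT σ (par c)    = par c
  substT σ (app f ts) = app f (substTs σ ts)
  substTs σ []       = []
  substTs σ (t ∷ ts) = substT σ t ∷ substTs σ ts

  shiftSeq : Seq L C
  shiftSeq k = var (suc k)

  _⁺ᵗ : Term L C → Term L C
  t ⁺ᵗ = substT shiftSeq t

  liftSeq : Seq L C → Seq L C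
  liftSeq σ zero    = var 0
  liftSeq σ (suc k) = (σ k) ⁺ᵗ

  substF : Seq L C → Formula L C → Formula L C
  substF σ (atom P ts) = atom P (substTs σ ts)
  substF σ (A ⇒ B)     = substF σ A ⇒ substF σ B
  substF σ (all A)     = all (substF (liftSeq σ) A)

  _⁺ : Formula L C → Formula L C
  A ⁺ = substF shiftSeq A

  minusSeq : Seq L C
  minusSeq zero    = var 0
  minusSeq (suc k) = var k

  _⁻ : Formula L C → Formula L C
  A ⁻ = substF minusSeq A

  -- sequence x₁, …, x_{i}, t, x_{i+2}, …  with t in position (i+1), i.e. at index i
  replSeq : ℕ → Term L C → Seq L C
  replSeq i t k = if k ≡ᵇ i then t else var k

  _[_/_] : Formula L C → Term L C → ℕ → Formula L C
  D [ t / i ] = substF (replSeq i t) D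

  Independent : Formula L C → ℕ → Set
  Independent D i = D ≡ D [ var (suc i) / i ]

  forallSeq : ℕ → Seq L C
  forallSeq i k = if k ≡ᵇ i then var 0 else var (suc k)

  -- (∀ var i) A := ∀ (A[x₂, …, x_i, x₁, x_{i+2}, …])
  forallVar : ℕ → Formula L C → Formula L C
  forallVar i A = all (substF (forallSeq i) A)

  -- the sequence x_i, x₁, x₂, … for the variable x_i = var j
  -- (position 1 ↦ var j, position k ≥ 2 ↦ x_{k-1})
  frontSeq : ℕ → Seq L C
  frontSeq j zero    = var j
  frontSeq j (suc k) = var k

-- Every clause is an identity between two substitution instances of A.  Substitutions
-- compose, so each reduces to comparing two sequences of terms, and a formula
-- independent of x_k is insensitive to what a sequence puts at position k.  Items 1
-- and 2 are instances of this with sequences that differ only at the position of the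
-- absent variable; items 3 and 4 hold for all A because the sequences agree everywhere.
module Submission where

open import Defs
open import Data.Nat using (ℕ; suc; zero; _≡ᵇ_)
open import Data.Nat.Properties using (≡ᵇ⇒≡; ≡⇒≡ᵇ; 1+n≢n)
open import Data.Bool using (true; false; T; if_then_else_)
open import Data.Empty using (⊥-elim)
open import Data.Vec using (Vec; []; _∷_)
open import Data.Product using (_×_; _,_)
open import Function using (_∘_)
open import Relation.Binary.PropositionalEquality
  using (_≡_; _≢_; _≗_; refl; sym; trans; cong; cong₂; subst; module ≡-Reasoning)

if-≡ᵇ-refl : ∀ {A : Set} n (a b : A) → (if n ≡ᵇ n then a else b) ≡ a
if-≡ᵇ-refl n a b with n ≡ᵇ n | ≡⇒≡ᵇ n n refl
... | true | _ = refl

if-≡ᵇ-≢ : ∀ {A : Set} {m n} (a b : A) → m ≢ n → (if m ≡ᵇ n then a else b) ≡ b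
if-≡ᵇ-≢ {m = m} {n} a b m≢n with m ≡ᵇ n in eq
... | true  = ⊥-elim (m≢n (≡ᵇ⇒≡ m n (subst T (sym eq) _)))
... | false = refl

module _ {L : Language} {C : Set} where

  infixr 9 _⊙_

  _⊙_ : Seq L C → Seq L C → Seq L C
  (σ ⊙ τ) k = substT σ (τ k)

  substT-cong : ∀ {σ τ : Seq L C} → σ ≗ τ → ∀ t → substT σ t ≡ substT τ t
  substTs-cong : ∀ {σ τ : Seq L C} {n} → σ ≗ τ → (ts : Vec (Term L C) n) → substTs σ ts ≡ substTs τ ts
  substT-cong σ≗τ (var i)    = σ≗τ i
  substT-cong σ≗τ (par c)    = refl
  substT-cong σ≗τ (app f ts) = cong (app f) (substTs-cong σ≗τ ts)
  substTs-cong σ≗τ []       = refl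
  substTs-cong σ≗τ (t ∷ ts) = cong₂ _∷_ (substT-cong σ≗τ t) (substTs-cong σ≗τ ts)

  liftSeq-cong : ∀ {σ τ : Seq L C} → σ ≗ τ → liftSeq σ ≗ liftSeq τ
  liftSeq-cong σ≗τ zero    = refl
  liftSeq-cong σ≗τ (suc k) = cong _⁺ᵗ (σ≗τ k)

  substF-cong : ∀ {σ τ : Seq L C} → σ ≗ τ → ∀ A → substF σ A ≡ substF τ A
  substF-cong σ≗τ (atom P ts) = cong (atom P) (substTs-cong σ≗τ ts)
  substF-cong σ≗τ (A ⇒ B)     = cong₂ _⇒_ (substF-cong σ≗τ A) (substF-cong σ≗τ B)
  substF-cong σ≗τ (all A)     = cong all (substF-cong (liftSeq-cong σ≗τ) A)

  substT-⊙ : ∀ σ τ t → substT σ (substT τ t) ≡ substT (σ ⊙ τ) t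
  substTs-⊙ : ∀ σ τ {n} (ts : Vec (Term L C) n) → substTs σ (substTs τ ts) ≡ substTs (σ ⊙ τ) ts
  substT-⊙ σ τ (var i)    = refl
  substT-⊙ σ τ (par c)    = refl
  substT-⊙ σ τ (app f ts) = cong (app f) (substTs-⊙ σ τ ts)
  substTs-⊙ σ τ []       = refl
  substTs-⊙ σ τ (t ∷ ts) = cong₂ _∷_ (substT-⊙ σ τ t) (substTs-⊙ σ τ ts)

  -- The middle term is also substT (shiftSeq ⊙ σ) (τ k): liftSeq σ sends x_{k+2} to (σ k)⁺.
  liftSeq-⊙ : ∀ σ τ → liftSeq σ ⊙ liftSeq τ ≗ liftSeq (σ ⊙ τ)
  liftSeq-⊙ σ τ zero    = refl
  liftSeq-⊙ σ τ (suc k) = begin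
    substT (liftSeq σ) (substT shiftSeq (τ k))  ≡⟨ substT-⊙ (liftSeq σ) shiftSeq (τ k) ⟩
    substT (liftSeq σ ⊙ shiftSeq) (τ k)         ≡⟨ sym (substT-⊙ shiftSeq σ (τ k)) ⟩
    substT shiftSeq (substT σ (τ k))            ∎
    where open ≡-Reasoning

  substF-⊙ : ∀ σ τ A → substF σ (substF τ A) ≡ substF (σ ⊙ τ) A
  substF-⊙ σ τ (atom P ts) = cong (atom P) (substTs-⊙ σ τ ts)
  substF-⊙ σ τ (A ⇒ B)     = cong₂ _⇒_ (substF-⊙ σ τ A) (substF-⊙ σ τ B)
  substF-⊙ σ τ (all A)     =
    cong all (trans (substF-⊙ (liftSeq σ) (liftSeq τ) A) (substF-cong (liftSeq-⊙ σ τ) A))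

  substT-var : ∀ t → substT var t ≡ t
  substTs-var : ∀ {n} (ts : Vec (Term L C) n) → substTs var ts ≡ ts
  substT-var (var i)    = refl
  substT-var (par c)    = refl
  substT-var (app f ts) = cong (app f) (substTs-var ts)
  substTs-var []       = refl
  substTs-var (t ∷ ts) = cong₂ _∷_ (substT-var t) (substTs-var ts)

  liftSeq-var : liftSeq {L} {C} var ≗ var
  liftSeq-var zero    = refl
  liftSeq-var (suc k) = refl

  substF-var : ∀ {σ : Seq L C} → σ ≗ var → ∀ A → substF σ A ≡ A
  substF-var σ≗var (atom P ts) = cong (atom P) (trans (substTs-cong σ≗var ts) (substTs-var ts))
  substF-var σ≗var (A ⇒ B)     = cong₂ _⇒_ (substF-var σ≗var A) (substF-var σ≗var B)
  substF-var σ≗var (all A)     =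
    cong all (substF-var (λ k → trans (liftSeq-cong σ≗var k) (liftSeq-var k)) A)

  ⊙-replSeq-cong : ∀ {σ τ : Seq L C} k → (∀ m → m ≢ k → σ m ≡ τ m) →
                   σ ⊙ replSeq k (var (suc k)) ≗ τ ⊙ replSeq k (var (suc k))
  ⊙-replSeq-cong k agree m with m ≡ᵇ k in eq
  ... | true  = agree (suc k) 1+n≢n
  ... | false = agree m (λ m≡k → subst T eq (≡⇒≡ᵇ m k m≡k))

  substF-independent : ∀ {σ τ : Seq L C} A k → Independent A k →
                       (∀ m → m ≢ k → σ m ≡ τ m) → substF σ A ≡ substF τ A
  substF-independent {σ} {τ} A k indep agree = begin
    substF σ A                  ≡⟨ cong (substF σ) indep ⟩
    substF σ (A [ x / k ])      ≡⟨ substF-⊙ σ r A ⟩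
    substF (σ ⊙ r) A            ≡⟨ substF-cong (⊙-replSeq-cong k agree) A ⟩
    substF (τ ⊙ r) A            ≡⟨ sym (substF-⊙ τ r A) ⟩
    substF τ (A [ x / k ])      ≡⟨ cong (substF τ) (sym indep) ⟩
    substF τ A                  ∎
    where
    open ≡-Reasoning
    x = var (suc k)
    r = replSeq k x

  forallSeq-⊙-frontSeq : ∀ j m → m ≢ suc j → (forallSeq j ⊙ frontSeq j) m ≡ var m
  forallSeq-⊙-frontSeq j zero    _       = if-≡ᵇ-refl j (var 0) (var (suc j))
  forallSeq-⊙-frontSeq j (suc n) n+1≢j+1 = if-≡ᵇ-≢ (var 0) (var (suc n)) (n+1≢j+1 ∘ cong suc)

  forallSeq≗shiftSeq : ∀ k m → m ≢ k → forallSeq {L} {C} k m ≡ shiftSeq m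
  forallSeq≗shiftSeq k m m≢k = if-≡ᵇ-≢ (var 0) (var (suc m)) m≢k

  forallSeq0≗liftSeq-shiftSeq : forallSeq {L} {C} 0 ≗ liftSeq shiftSeq
  forallSeq0≗liftSeq-shiftSeq zero    = refl
  forallSeq0≗liftSeq-shiftSeq (suc k) = refl

  liftSeq-minusSeq-⊙-forallSeq0 : liftSeq minusSeq ⊙ forallSeq 0 ≗ var
  liftSeq-minusSeq-⊙-forallSeq0 zero    = refl
  liftSeq-minusSeq-⊙-forallSeq0 (suc k) = refl

  all≡forallVar-front : ∀ A j → Independent A (suc j) →
                        all A ≡ forallVar j (substF (frontSeq j) A)
  all≡forallVar-front A j indep = cong all (begin
    A                                              ≡⟨ sym (substF-var (λ _ → refl) A) ⟩
    substF var A                                   ≡⟨ substF-independent A (suc j) indep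
                                                        (λ m m≢ → sym (forallSeq-⊙-frontSeq j m m≢)) ⟩
    substF (forallSeq j ⊙ frontSeq j) A            ≡⟨ sym (substF-⊙ (forallSeq j) (frontSeq j) A) ⟩
    substF (forallSeq j) (substF (frontSeq j) A)   ∎)
    where open ≡-Reasoning

  forallVar-independent : ∀ A k → Independent A k → forallVar k A ≡ all (A ⁺)
  forallVar-independent A k indep =
    cong all (substF-independent A k indep (forallSeq≗shiftSeq k))

  forallVar0≡all⁺ : ∀ A → forallVar 0 A ≡ (all A) ⁺
  forallVar0≡all⁺ A = cong all (substF-cong forallSeq0≗liftSeq-shiftSeq A)

  all≡forallVar0⁻ : ∀ A → all A ≡ (forallVar 0 A) ⁻
  all≡forallVar0⁻ A = cong all (sym (begin
    substF (liftSeq minusSeq) (substF (forallSeq 0) A)  ≡⟨ substF-⊙ (liftSeq minusSeq) (forallSeq 0) A ⟩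
    substF (liftSeq minusSeq ⊙ forallSeq 0) A           ≡⟨ substF-var liftSeq-minusSeq-⊙-forallSeq0 A ⟩
    A                                                   ∎))
    where open ≡-Reasoning

mainTheorem2 : (L : Language) (C : Set) (A : Formula L C) →
    ((j : ℕ) → Independent A (suc j) →
    all A ≡ forallVar j (substF (frontSeq j) A))
    × ((k : ℕ) → Independent A k → forallVar k A ≡ all (A ⁺))
    × (forallVar 0 A ≡ (all A) ⁺ × all A ≡ (forallVar 0 A) ⁻)
    × ((j : ℕ) → forallVar j A ≡ (forallVar 0 (substF (forallSeq j) A)) ⁻)
mainTheorem2 L C A =
    all≡forallVar-front A
  , forallVar-independent A
  , (forallVar0≡all⁺ A , all≡forallVar0⁻ A)
  , λ j → all≡forallVar0⁻ (substF (forallSeq j) A)
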